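{- Every non-negative integer can be written as a sum of four Fibternary numbers, and every non-negative integer can be written as a sum of three Tribternary numbers.
   Context: A non-negative integer is Fibternary if its base-3 representation uses only the digits $0$ and $1$ and contains no two consecutive $1$s. It is Tribternary if its base-3 representation uses only the digits $0$ and $1$ and contains no three consecutive $1$s. ($0$ is both Fibternary and Tribternary.) -}

module Defs where

open import Data.Nat using (ℕ; zero; suc; _+_; _*_; _<_)
open import Data.Nat.DivMod using (_/_; _%_)
open import Data.List using (List; []; _∷_)

-- Base-3 digits, least significant first, computed with fuel.
-- Fuel n suffices for any number ≤ n (each step divides by 3, and x/3 < x for x > 0).
-- 0 has the empty digit list.
digits3-fuel : ℕ → ℕ → List ℕ
digits3-fuel zero    _ = []
digits3-fuel (suc f) zero = []
digits3-fuel (suc f) (suc m) = (suc m % 3) ∷ digits3-fuel f (suc m / 3)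

base3 : ℕ → List ℕ
base3 n = digits3-fuel n n

-- Digit list uses only 0 and 1, and has no run of k consecutive 1s.
-- 'run' counts the current trailing run of 1s.
data NoRun (k : ℕ) : ℕ → List ℕ → Set where
  nil  : ∀ {r} → NoRun k r []
  zero∷ : ∀ {r ds} → NoRun k 0 ds → NoRun k r (0 ∷ ds)
  one∷  : ∀ {r ds} → suc r < k → NoRun k (suc r) ds → NoRun k r (1 ∷ ds)

Fibternary : ℕ → Set
Fibternary n = NoRun 2 0 (base3 n)

Tribternary : ℕ → Set
Tribternary n = NoRun 3 0 (base3 n)

-- Build the summands digit by digit, from the most significant ternary digit of n down:
-- writing n = e + 3q, a representation of q is shifted by one place and each summand gets
-- a new last digit 0 or 1, these digits adding up to e ∈ {0,1,2}.  For four Fibternary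
-- summands the invariant is that two of them end in 0: they receive the 1s, while the
-- other two receive a 0 and take over that role.  For three Tribternary summands one
-- summand ends in 0 and another ends in at most one 1: a digit 1 goes to the first, a
-- digit 2 to the first two; the first then ends in a single 1, and a summand that
-- received a 0 ends in 0, which restores the invariant.
module Submission where

open import Defs
open import Data.Nat using (ℕ; _+_)
open import Data.Product using (_×_; ∃-syntax)
open import Relation.Binary.PropositionalEquality using (_≡_)

open import Data.Nat using (zero; suc; _*_; _≤_; _<_; z≤n; s≤s; NonZero; _/_; _%_)
open import Data.Nat.Properties using (≤-refl; ≤-trans; ≤-<-trans; ≤-pred; +-cancelˡ-≡; *-cancelʳ-≡)
open import Data.Nat.DivMod using (m≡m%n+[m/n]*n; m%n<n; [m+kn]%n≡m%n; m<n⇒m%n≡m; m/n<m)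
open import Data.Nat.Induction using (<-rec)
open import Data.Nat.Tactic.RingSolver using (solve)
open import Data.List using ([]; _∷_)
open import Data.Product using (_,_)
open import Relation.Binary.PropositionalEquality using (refl; sym; trans; cong; cong₂; subst; module ≡-Reasoning)

[m+kn]%n≡m : ∀ {m} k {n} .{{_ : NonZero n}} → m < n → (m + k * n) % n ≡ m
[m+kn]%n≡m {m} k {n} m<n = trans ([m+kn]%n≡m%n m k n) (m<n⇒m%n≡m m<n)

[m+kn]/n≡k : ∀ {m} k {n} .{{_ : NonZero n}} → m < n → (m + k * n) / n ≡ k
[m+kn]/n≡k {m} k {n} m<n = *-cancelʳ-≡ _ _ n (+-cancelˡ-≡ m _ _ (begin
    m + (m + k * n) / n * n                    ≡⟨ cong (_+ (m + k * n) / n * n) ([m+kn]%n≡m k m<n) ⟨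
    (m + k * n) % n + (m + k * n) / n * n      ≡⟨ m≡m%n+[m/n]*n (m + k * n) n ⟨
    m + k * n                                  ∎))
  where open ≡-Reasoning

suc[m]/3≤m : ∀ m → suc m / 3 ≤ m
suc[m]/3≤m m = ≤-pred (m/n<m (suc m) 3 (s≤s (s≤s z≤n)))

digits3-fuel-cong : ∀ f g m → m ≤ f → m ≤ g → digits3-fuel f m ≡ digits3-fuel g m
digits3-fuel-cong zero    zero    zero    _       _       = refl
digits3-fuel-cong zero    (suc g) zero    _       _       = refl
digits3-fuel-cong (suc f) zero    zero    _       _       = refl
digits3-fuel-cong (suc f) (suc g) zero    _       _       = refl
digits3-fuel-cong (suc f) (suc g) (suc m) (s≤s m≤f) (s≤s m≤g) =
  cong (suc m % 3 ∷_) (digits3-fuel-cong f g (suc m / 3) (≤-trans (suc[m]/3≤m m) m≤f) (≤-trans (suc[m]/3≤m m) m≤g))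

base3-nonZero : ∀ n .{{_ : NonZero n}} → base3 n ≡ n % 3 ∷ base3 (n / 3)
base3-nonZero (suc m) = cong (suc m % 3 ∷_) (digits3-fuel-cong m (suc m / 3) (suc m / 3) (suc[m]/3≤m m) ≤-refl)

base3-digit∷ : ∀ {d} x → d < 3 → .{{_ : NonZero (d + x * 3)}} → base3 (d + x * 3) ≡ d ∷ base3 x
base3-digit∷ {d} x d<3 = trans (base3-nonZero (d + x * 3)) (cong₂ _∷_ ([m+kn]%n≡m x d<3) (cong base3 ([m+kn]/n≡k x d<3)))

ternary-induction : (P : ℕ → Set) → P 0 → (∀ d q → d < 3 → P q → P (d + q * 3)) → ∀ n → P n
ternary-induction P P0 step = <-rec P λ
  { zero    _  → P0
  ; (suc m) ih → subst P (sym (m≡m%n+[m/n]*n (suc m) 3))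
                   (step (suc m % 3) (suc m / 3) (m%n<n (suc m) 3) (ih (s≤s (suc[m]/3≤m m))))
  }

NoRun-weaken : ∀ {k r r′ ds} → r′ ≤ r → NoRun k r ds → NoRun k r′ ds
NoRun-weaken r′≤r nil          = nil
NoRun-weaken r′≤r (zero∷ p)    = zero∷ p
NoRun-weaken r′≤r (one∷ r<k p) = one∷ (≤-<-trans (s≤s r′≤r) r<k) (NoRun-weaken (s≤s r′≤r) p)

-- The ternary digits of n are 0 or 1 with no k consecutive 1s, even when r further 1s are
-- placed below the least significant digit.
NoRun₃ : ℕ → ℕ → ℕ → Set
NoRun₃ k r n = NoRun k r (base3 n)

NoRun₃-*3 : ∀ {k} r x → NoRun₃ k 0 x → NoRun₃ k r (x * 3)
NoRun₃-*3     r zero    p = nil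
NoRun₃-*3 {k} r (suc x) p = subst (NoRun k r) (sym (base3-digit∷ (suc x) (s≤s z≤n))) (zero∷ p)

NoRun₃-1+*3 : ∀ {k} r x → suc r < k → NoRun₃ k (suc r) x → NoRun₃ k r (1 + x * 3)
NoRun₃-1+*3 {k} r x r<k p = subst (NoRun k r) (sym (base3-digit∷ x (s≤s (s≤s z≤n)))) (one∷ r<k p)

FibternaryInvariant : ℕ → Set
FibternaryInvariant n = ∃[ a ] ∃[ b ] ∃[ c ] ∃[ d ]
  (NoRun₃ 2 0 a × NoRun₃ 2 0 b × NoRun₃ 2 1 c × NoRun₃ 2 1 d × a + b + c + d ≡ n)

FibternaryInvariant-step : ∀ e q → e < 3 → FibternaryInvariant q → FibternaryInvariant (e + q * 3)
FibternaryInvariant-step 0 _ _ (a , b , c , d , pa , pb , pc , pd , refl) =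
  a * 3 , b * 3 , c * 3 , d * 3 ,
  NoRun₃-*3 0 a pa , NoRun₃-*3 0 b pb ,
  NoRun₃-*3 1 c (NoRun-weaken z≤n pc) , NoRun₃-*3 1 d (NoRun-weaken z≤n pd) ,
  solve (a ∷ b ∷ c ∷ d ∷ [])
FibternaryInvariant-step 1 _ _ (a , b , c , d , pa , pb , pc , pd , refl) =
  1 + c * 3 , d * 3 , a * 3 , b * 3 ,
  NoRun₃-1+*3 0 c (s≤s (s≤s z≤n)) pc , NoRun₃-*3 0 d (NoRun-weaken z≤n pd) ,
  NoRun₃-*3 1 a pa , NoRun₃-*3 1 b pb ,
  solve (a ∷ b ∷ c ∷ d ∷ [])
FibternaryInvariant-step 2 _ _ (a , b , c , d , pa , pb , pc , pd , refl) =
  1 + c * 3 , 1 + d * 3 , a * 3 , b * 3 ,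
  NoRun₃-1+*3 0 c (s≤s (s≤s z≤n)) pc , NoRun₃-1+*3 0 d (s≤s (s≤s z≤n)) pd ,
  NoRun₃-*3 1 a pa , NoRun₃-*3 1 b pb ,
  solve (a ∷ b ∷ c ∷ d ∷ [])
FibternaryInvariant-step (suc (suc (suc _))) _ (s≤s (s≤s (s≤s ()))) _

TribternaryInvariant : ℕ → Set
TribternaryInvariant n = ∃[ a ] ∃[ b ] ∃[ c ]
  (NoRun₃ 3 2 a × NoRun₃ 3 1 b × NoRun₃ 3 0 c × a + b + c ≡ n)

TribternaryInvariant-step : ∀ e q → e < 3 → TribternaryInvariant q → TribternaryInvariant (e + q * 3)
TribternaryInvariant-step 0 _ _ (a , b , c , pa , pb , pc , refl) =
  a * 3 , b * 3 , c * 3 ,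
  NoRun₃-*3 2 a (NoRun-weaken z≤n pa) , NoRun₃-*3 1 b (NoRun-weaken z≤n pb) , NoRun₃-*3 0 c pc ,
  solve (a ∷ b ∷ c ∷ [])
TribternaryInvariant-step 1 _ _ (a , b , c , pa , pb , pc , refl) =
  b * 3 , 1 + a * 3 , c * 3 ,
  NoRun₃-*3 2 b (NoRun-weaken z≤n pb) , NoRun₃-1+*3 1 a (s≤s (s≤s (s≤s z≤n))) pa , NoRun₃-*3 0 c pc ,
  solve (a ∷ b ∷ c ∷ [])
TribternaryInvariant-step 2 _ _ (a , b , c , pa , pb , pc , refl) =
  c * 3 , 1 + a * 3 , 1 + b * 3 ,
  NoRun₃-*3 2 c pc , NoRun₃-1+*3 1 a (s≤s (s≤s (s≤s z≤n))) pa , NoRun₃-1+*3 0 b (s≤s (s≤s z≤n)) pb ,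
  solve (a ∷ b ∷ c ∷ [])
TribternaryInvariant-step (suc (suc (suc _))) _ (s≤s (s≤s (s≤s ()))) _

mainTheorem20 : ((n : ℕ) → ∃[ a ] ∃[ b ] ∃[ c ] ∃[ d ] (Fibternary a × Fibternary b × Fibternary c × Fibternary d × a + b + c + d ≡ n))
    × ((n : ℕ) → ∃[ a ] ∃[ b ] ∃[ c ] (Tribternary a × Tribternary b × Tribternary c × a + b + c ≡ n))
mainTheorem20 = fibternary-sum , tribternary-sum
  where
  fibternary-sum : (n : ℕ) → ∃[ a ] ∃[ b ] ∃[ c ] ∃[ d ] (Fibternary a × Fibternary b × Fibternary c × Fibternary d × a + b + c + d ≡ n)
  fibternary-sum n with ternary-induction FibternaryInvariant (0 , 0 , 0 , 0 , nil , nil , nil , nil , refl) FibternaryInvariant-step n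
  ... | a , b , c , d , pa , pb , pc , pd , sum = a , b , c , d , pa , pb , NoRun-weaken z≤n pc , NoRun-weaken z≤n pd , sum

  tribternary-sum : (n : ℕ) → ∃[ a ] ∃[ b ] ∃[ c ] (Tribternary a × Tribternary b × Tribternary c × a + b + c ≡ n)
  tribternary-sum n with ternary-induction TribternaryInvariant (0 , 0 , 0 , nil , nil , nil , refl) TribternaryInvariant-step n
  ... | a , b , c , pa , pb , pc , sum = a , b , c , NoRun-weaken z≤n pa , NoRun-weaken z≤n pb , pc , sum
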